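{- For every $n\ge3$, $\#\mathrm{Av}_n([1324],[1423])=2^{n-2}$.
   Context: For a linear permutation $\pi=\pi_1\ldots\pi_n$ of $[n]$, the cyclic permutation $[\pi]$ is the set of all rotations of $\pi$. A linear permutation $\sigma$ contains $\pi$ if some subsequence of $\sigma$ is order isomorphic to $\pi$ (same relative order). A cyclic permutation $[\sigma]$ contains $[\pi]$ if some rotation of $\sigma$ contains $\pi$; otherwise it avoids $[\pi]$. For a set of cyclic patterns $[\Pi]$, $\mathrm{Av}_n[\Pi]$ denotes the set of cyclic permutations of length $n$ avoiding every pattern in $[\Pi]$. -}

module Defs where

open import Data.Bool using (Bool; true; false; _∧_; _∨_; not; if_then_else_)
open import Data.Nat using (ℕ; zero; suc; _<ᵇ_; _≡ᵇ_)
open import Data.List using (List; []; _∷_; map; concatMap; _++_; take; drop; length; upTo; filter; zip)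
open import Data.Bool.ListAction using (any; all)
open import Data.Product using (_,_)
open import Relation.Nullary.Decidable using (Dec; yes; no)
open import Relation.Binary.PropositionalEquality using (_≡_; refl)
open import Data.Bool.Properties using (_≟_)

words : ℕ → ℕ → List (List ℕ)
words m zero    = [] ∷ []
words m (suc k) = concatMap (λ x → map (x ∷_) (words m k)) (upTo m)

distinct : List ℕ → Bool
distinct []       = true
distinct (x ∷ xs) = not (any (x ≡ᵇ_) xs) ∧ distinct xs

perms : ℕ → List (List ℕ)
perms n = filter (λ w → distinct w ≟ true) (words n n)

subseqs : List ℕ → List (List ℕ)
subseqs []       = [] ∷ []
subseqs (x ∷ xs) = map (x ∷_) (subseqs xs) ++ subseqs xs

iffᵇ : Bool → Bool → Bool
iffᵇ true  b = b
iffᵇ false b = not b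

orderIso : List ℕ → List ℕ → Bool
orderIso []       []       = true
orderIso []       (_ ∷ _)  = false
orderIso (_ ∷ _)  []       = false
orderIso (a ∷ s)  (b ∷ p)  =
  (length s ≡ᵇ length p)
  ∧ all (λ { (x , y) → iffᵇ (a <ᵇ x) (b <ᵇ y) ∧ iffᵇ (x <ᵇ a) (y <ᵇ b) }) (zip s p)
  ∧ orderIso s p

contains : List ℕ → List ℕ → Bool
contains σ π = any (λ s → orderIso s π) (subseqs σ)

rotate : ℕ → List ℕ → List ℕ
rotate k σ = drop k σ ++ take k σ

rotations : List ℕ → List (List ℕ)
rotations σ = map (λ k → rotate k σ) (upTo (length σ))

cycContains : List ℕ → List ℕ → Bool
cycContains σ π = any (λ τ → contains τ π) (rotations σ)

cycAvoidsAll : List (List ℕ) → List ℕ → Bool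
cycAvoidsAll Π σ = all (λ π → not (cycContains σ π)) Π

eqList : List ℕ → List ℕ → Bool
eqList []       []       = true
eqList []       (_ ∷ _)  = false
eqList (_ ∷ _)  []       = false
eqList (x ∷ xs) (y ∷ ys) = (x ≡ᵇ y) ∧ eqList xs ys

-- σ and τ represent the same cyclic permutation (τ is a rotation of σ).
sameCyc : List ℕ → List ℕ → Bool
sameCyc σ τ = any (eqList τ) (rotations σ)

-- Number of equivalence classes (cyclic permutations) among a list of
-- linear permutations: count elements with no later rotation-equivalent element.
countClasses : List (List ℕ) → ℕ
countClasses []       = zero
countClasses (x ∷ xs) = if any (sameCyc x) xs then countClasses xs else suc (countClasses xs)

numAv : ℕ → List (List ℕ) → ℕ
numAv n Π = countClasses (filter (λ σ → cycAvoidsAll Π σ ≟ true) (perms n))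

{-# OPTIONS --safe #-}
-- Rotating a cyclic permutation so that it starts with its least entry 0 picks one
-- representative 0 ∷ α per class.  Every occurrence of 1324 or 1423 is a least entry
-- followed by a valley (an entry below one earlier and one later entry), and every
-- rotation of such a four-element word still contains a valley; conversely, if α has a
-- valley x y z, then 0 x y z is an occurrence of 1324 (when x < z) or of 1423 (when
-- z < x).  Hence the class of 0 ∷ α avoids both patterns iff α has no valley, i.e. α
-- increases and then decreases.  Such an α is determined by placing each of its entries
-- except the largest at the left or the right end, so there are 2^(n-2) classes.
module Submission where

open import Defs
open import Data.Bool using (Bool; true; false; T; not; _∧_; if_then_else_)
open import Data.Bool.ListAction using (any; all)
open import Data.Bool.Properties using (T-∧; T-≡) renaming (_≟_ to _≟ᵇ_)
open import Data.Empty using (⊥; ⊥-elim)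
open import Data.Nat
open import Data.Nat.Properties
open import Data.List
  using (List; []; _∷_; [_]; _++_; length; map; zip; filter; upTo; applyUpTo; take; drop)
open import Data.List.Properties
  using (++-identityʳ; ++-assoc; ∷-injective; ∷-injectiveʳ; ∷ʳ-injective; ∷ʳ-injectiveˡ; length-++
        ; length-++-≤ˡ; length-map; length-applyUpTo; take++drop≡id)
open import Data.List.Membership.Propositional using (_∈_; _∉_; find; lose)
open import Data.List.Membership.Propositional.Properties
  using (∈-++⁻; ∈-++⁺ˡ; ∈-++⁺ʳ; ∈-map⁺; ∈-map⁻; ∈-∃++; ∈-insert; ∈-concat⁺′; ∈-concat⁻′; ∈-upTo⁺
        ; ∈-upTo⁻; ∈-applyUpTo⁺; ∈-filter⁺; ∈-filter⁻)
open import Data.List.Relation.Unary.Any using (Any; here; there; any?)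
open import Data.List.Relation.Unary.Any.Properties using (any⁺; any⁻)
open import Data.List.Relation.Unary.All as All using (All; []; _∷_)
open import Data.List.Relation.Unary.All.Properties using (All¬⇒¬Any; all⁺; all⁻)
open import Data.List.Relation.Unary.Unique.Propositional using (Unique; []; _∷_)
import Data.List.Relation.Unary.Unique.Propositional.Properties as Unique
open import Data.List.Relation.Binary.Sublist.Propositional
  using (_⊆_; []; _∷_; _∷ʳ_; ⊆-refl; ⊆-trans)
open import Data.List.Relation.Binary.Sublist.Propositional.Properties
  using (All-resp-⊆; Any-resp-⊆; ++⁺; ++⁺ˡ; []⊆-universal)
open import Data.List.Relation.Binary.Pointwise using (Pointwise; []; _∷_; Pointwise-length)
open import Data.List.Relation.Binary.Permutation.Propositional using (_↭_; ↭⇒↭ₛ)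
open import Data.List.Relation.Binary.Permutation.Propositional.Properties
  using (++-comm; shift; ↭-length; All-resp-↭)
import Data.List.Relation.Binary.Permutation.Setoid.Properties as Setoid↭
open import Data.Product using (∃₂; ∃-syntax; _×_; _,_; proj₁; proj₂)
open import Data.Sum using (_⊎_; inj₁; inj₂)
open import Function using (_∘_; _⇔_; mk⇔; Equivalence)
open import Relation.Nullary using (¬_; contradiction; yes; no)
open import Relation.Binary.Definitions using (DecidableEquality; Tri; tri<; tri≈; tri>)
open import Relation.Nullary.Reflects using (Reflects; ofʸ; ofⁿ; _×-reflects_)
open import Relation.Binary.PropositionalEquality
  using (_≡_; _≢_; refl; sym; trans; cong; cong₂; subst; setoid; module ≡-Reasoning)

open Equivalence using (to; from)

private
  variable
    A : Set
    x y z : A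
    xs ys zs us vs : List A

T-∧⁻ : ∀ a {b} → T (a ∧ b) → T a × T b
T-∧⁻ a = to (T-∧ {a})

T-∧⁺ : ∀ a {b} → T a → T b → T (a ∧ b)
T-∧⁺ a p q = from (T-∧ {a}) (p , q)

T-not⇔¬T : ∀ {b} → T (not b) ⇔ (¬ T b)
T-not⇔¬T {true}  = mk⇔ (λ ()) (λ ¬t → ¬t _)
T-not⇔¬T {false} = mk⇔ (λ _ ()) _

Reflects⇒T⇔ : ∀ {P : Set} {b} → Reflects P b → T b ⇔ P
Reflects⇒T⇔ (ofʸ p)  = mk⇔ (λ _ → p) _
Reflects⇒T⇔ (ofⁿ ¬p) = mk⇔ (λ ()) ¬p

iffᵇ-reflects : ∀ {P Q : Set} {u v} → Reflects P u → Reflects Q v → Reflects (P ⇔ Q) (iffᵇ u v)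
iffᵇ-reflects (ofʸ p)  (ofʸ q)  = ofʸ (mk⇔ (λ _ → q) (λ _ → p))
iffᵇ-reflects (ofʸ p)  (ofⁿ ¬q) = ofⁿ (λ p⇔q → ¬q (to p⇔q p))
iffᵇ-reflects (ofⁿ ¬p) (ofʸ q)  = ofⁿ (λ p⇔q → ¬p (from p⇔q q))
iffᵇ-reflects (ofⁿ ¬p) (ofⁿ ¬q) = ofʸ (mk⇔ (⊥-elim ∘ ¬p) (⊥-elim ∘ ¬q))

any-∈⁻ : ∀ (p : A → Bool) xs → T (any p xs) → ∃[ x ] x ∈ xs × T (p x)
any-∈⁻ p xs = find ∘ any⁻ p xs

any-∈⁺ : ∀ (p : A → Bool) → x ∈ xs → T (p x) → T (any p xs)
any-∈⁺ p x∈xs px = any⁺ p (lose x∈xs px)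

∈-delete : ∀ us → z ∈ us ++ x ∷ vs → z ≢ x → z ∈ us ++ vs
∈-delete us z∈ z≢x with ∈-++⁻ us z∈
... | inj₁ z∈us         = ∈-++⁺ˡ z∈us
... | inj₂ (here z≡x)   = contradiction z≡x z≢x
... | inj₂ (there z∈vs) = ∈-++⁺ʳ us z∈vs

delete-⊆ : ∀ us → us ++ vs ⊆ us ++ x ∷ vs
delete-⊆ {x = x} us = ++⁺ (⊆-refl {x = us}) (x ∷ʳ ⊆-refl)

length-insert : ∀ us → length (us ++ x ∷ vs) ≡ suc (length (us ++ vs))
length-insert []       = refl
length-insert (u ∷ us) = cong suc (length-insert us)

Unique-resp-⊆ : xs ⊆ ys → Unique ys → Unique xs
Unique-resp-⊆ []         u          = u
Unique-resp-⊆ (_ ∷ʳ p)   (_ ∷ u)    = Unique-resp-⊆ p u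
Unique-resp-⊆ (refl ∷ p) (x∉ ∷ u)   = All-resp-⊆ p x∉ ∷ Unique-resp-⊆ p u

Unique-resp-↭ : xs ↭ ys → Unique xs → Unique ys
Unique-resp-↭ p = Setoid↭.Unique-resp-↭ (setoid _) (↭⇒↭ₛ p)

Unique-⊆-≢ : x ∷ y ∷ [] ⊆ xs → Unique xs → x ≢ y
Unique-⊆-≢ p u with Unique-resp-⊆ p u
... | (x≢y ∷ []) ∷ _ = x≢y

Unique-delete : ∀ us → Unique (us ++ x ∷ vs) → x ∉ us ++ vs
Unique-delete []       (x∉vs ∷ _) x∈vs          = All¬⇒¬Any x∉vs x∈vs
Unique-delete (u ∷ us) (u∉ ∷ _)   (here refl)    = All.lookup u∉ (∈-insert us) refl
Unique-delete (u ∷ us) (_ ∷ uq)   (there x∈)     = Unique-delete us uq x∈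

unique-length-≤ : Unique xs → (∀ {z} → z ∈ xs → z ∈ ys) → length xs ≤ length ys
unique-length-≤ [] _ = z≤n
unique-length-≤ {xs = _ ∷ xs} {ys = ys} (x∉ ∷ u) xs⊆ys with ∈-∃++ (xs⊆ys (here refl))
... | us , vs , refl = begin
  suc (length xs)          ≤⟨ s≤s (unique-length-≤ u xs⊆us++vs) ⟩
  suc (length (us ++ vs))  ≡⟨ length-insert us ⟨
  length ys                ∎
  where
  open ≤-Reasoning
  xs⊆us++vs : ∀ {z} → z ∈ xs → z ∈ us ++ vs
  xs⊆us++vs z∈ = ∈-delete us (xs⊆ys (there z∈)) (λ { refl → All.lookup x∉ z∈ refl })

unique-length-≥⇒⊇ : {xs ys : List A} → DecidableEquality A → Unique xs → (∀ {z} → z ∈ xs → z ∈ ys) →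
                    length ys ≤ length xs → ∀ {y} → y ∈ ys → y ∈ xs
unique-length-≥⇒⊇ {xs = xs} _≟_ u xs⊆ys ys≤xs {y} y∈ys with any? (y ≟_) xs
... | yes y∈xs = y∈xs
... | no  y∉xs with ∈-∃++ y∈ys
...   | us , vs , refl = contradiction ys≤xs (<⇒≱ (begin-strict
  length xs                ≤⟨ unique-length-≤ u (λ z∈ → ∈-delete us (xs⊆ys z∈) (λ { refl → y∉xs z∈ })) ⟩
  length (us ++ vs)        <⟨ n<1+n _ ⟩
  suc (length (us ++ vs))  ≡⟨ length-insert us ⟨
  length (us ++ y ∷ vs)    ∎))
  where open ≤-Reasoning

⊆-++⁻ : ∀ us → xs ⊆ us ++ vs → ∃₂ λ xs₁ xs₂ → xs ≡ xs₁ ++ xs₂ × xs₁ ⊆ us × xs₂ ⊆ vs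
⊆-++⁻ []       p = [] , _ , refl , [] , p
⊆-++⁻ (u ∷ us) (.u ∷ʳ p) with ⊆-++⁻ us p
... | xs₁ , xs₂ , refl , p₁ , p₂ = xs₁ , xs₂ , refl , u ∷ʳ p₁ , p₂
⊆-++⁻ (u ∷ us) (refl ∷ p) with ⊆-++⁻ us p
... | xs₁ , xs₂ , refl , p₁ , p₂ = u ∷ xs₁ , xs₂ , refl , refl ∷ p₁ , p₂

++-≡-++⁻ : ∀ (as : List A) {bs cs ds} → as ++ bs ≡ cs ++ ds →
           (∃[ es ] cs ≡ as ++ es × bs ≡ es ++ ds) ⊎ (∃[ es ] as ≡ cs ++ es × ds ≡ es ++ bs)
++-≡-++⁻ []               eq = inj₁ (_ , refl , eq)
++-≡-++⁻ (a ∷ as) {cs = []}     eq = inj₂ (a ∷ as , refl , sym eq)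
++-≡-++⁻ (a ∷ as) {cs = c ∷ cs} eq with ∷-injective eq
... | refl , eq′ with ++-≡-++⁻ as {cs = cs} eq′
...   | inj₁ (es , refl , q) = inj₁ (es , refl , q)
...   | inj₂ (es , refl , q) = inj₂ (es , refl , q)

drop-length-++ : ∀ (us : List A) {vs : List A} → drop (length us) (us ++ vs) ≡ vs
drop-length-++ []       = refl
drop-length-++ (u ∷ us) = drop-length-++ us

take-length-++ : ∀ (us : List A) {vs : List A} → take (length us) (us ++ vs) ≡ us
take-length-++ []       = refl
take-length-++ (u ∷ us) = cong (u ∷_) (take-length-++ us)

classCount : (A → A → Bool) → List A → ℕ
classCount _∼_ []       = 0
classCount _∼_ (x ∷ xs) = if any (x ∼_) xs then classCount _∼_ xs else suc (classCount _∼_ xs)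

record Transversal (_∼_ : A → A → Bool) (L R : List A) : Set where
  field
    unique    : Unique R
    separated : ∀ {r s} → r ∈ R → s ∈ R → T (r ∼ s) → r ≡ s
    covers    : ∀ {x} → x ∈ L → ∃[ r ] r ∈ R × T (x ∼ r)
    hits      : ∀ {r} → r ∈ R → ∃[ x ] x ∈ L × T (r ∼ x)

module _ {A : Set} (_∼_ : A → A → Bool)
         (∼-sym : ∀ x y → T (x ∼ y) → T (y ∼ x))
         (∼-trans : ∀ x y z → T (x ∼ y) → T (y ∼ z) → T (x ∼ z)) where

  Transversal-tail : ∀ {x L R} → Transversal _∼_ (x ∷ L) R → T (any (x ∼_) L) → Transversal _∼_ L R
  Transversal-tail {x} {L} {R} t x∼L =
    record { unique = unique ; separated = separated ; covers = covers ∘ there ; hits = hits′ }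
    where
    open Transversal t
    hits′ : ∀ {r} → r ∈ R → ∃[ y ] y ∈ L × T (r ∼ y)
    hits′ r∈R with hits r∈R
    ... | y , there y∈L , r∼y = y , y∈L , r∼y
    ... | _ , here refl , r∼x with any-∈⁻ (x ∼_) L x∼L
    ...   | y , y∈L , x∼y = y , y∈L , ∼-trans _ _ _ r∼x x∼y

  Transversal-tail-delete : ∀ {x L r} us vs → Transversal _∼_ (x ∷ L) (us ++ r ∷ vs) →
                            ¬ T (any (x ∼_) L) → T (x ∼ r) → Transversal _∼_ L (us ++ vs)
  Transversal-tail-delete {x} {L} {r} us vs t x≁L x∼r = record
    { unique    = Unique-resp-⊆ (delete-⊆ us) unique
    ; separated = λ s∈ s′∈ → separated (weaken s∈) (weaken s′∈)
    ; covers    = covers′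
    ; hits      = λ s∈ → hits′ s∈ (hits (weaken s∈))
    }
    where
    open Transversal t
    weaken : ∀ {s} → s ∈ us ++ vs → s ∈ us ++ r ∷ vs
    weaken = Any-resp-⊆ (delete-⊆ us)
    covers′ : ∀ {y} → y ∈ L → ∃[ s ] s ∈ us ++ vs × T (y ∼ s)
    covers′ y∈L with covers (there y∈L)
    ... | s , s∈ , y∼s = s , ∈-delete us s∈ s≢r , y∼s
      where
      s≢r : s ≢ r
      s≢r refl = x≁L (any-∈⁺ (x ∼_) y∈L (∼-trans _ _ _ x∼r (∼-sym _ _ y∼s)))
    hits′ : ∀ {s} → s ∈ us ++ vs → ∃[ y ] y ∈ x ∷ L × T (s ∼ y) → ∃[ y ] y ∈ L × T (s ∼ y)
    hits′ _  (y , there y∈L , s∼y) = y , y∈L , s∼y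
    hits′ {s} s∈ (_ , here refl , s∼x) = contradiction (subst (_∈ us ++ vs) s≡r s∈) (Unique-delete us unique)
      where
      s≡r : s ≡ r
      s≡r = separated (weaken s∈) (∈-insert us) (∼-trans _ _ _ s∼x x∼r)

  classCount-transversal : ∀ L {R} → Transversal _∼_ L R → classCount _∼_ L ≡ length R
  classCount-transversal [] {[]}    _ = refl
  classCount-transversal [] {_ ∷ _} t with Transversal.hits t (here refl)
  ... | _ , () , _
  classCount-transversal (x ∷ L) t with any (x ∼_) L in e
  ... | true  = classCount-transversal L (Transversal-tail t (from T-≡ e))
  ... | false with Transversal.covers t (here refl)
  ...   | r , r∈R , x∼r with ∈-∃++ r∈R
  ...     | us , vs , refl = begin
    suc (classCount _∼_ L)   ≡⟨ cong suc (classCount-transversal L t′) ⟩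
    suc (length (us ++ vs))  ≡⟨ length-insert us ⟨
    length (us ++ r ∷ vs)    ∎
    where
    open ≡-Reasoning
    t′ : Transversal _∼_ L (us ++ vs)
    t′ = Transversal-tail-delete us vs t (subst T e) x∼r

countClasses≡classCount : ∀ L → countClasses L ≡ classCount sameCyc L
countClasses≡classCount []      = refl
countClasses≡classCount (x ∷ L) rewrite countClasses≡classCount L = refl

Rotation : List A → List A → Set
Rotation xs ys = ∃₂ λ us vs → xs ≡ us ++ vs × ys ≡ vs ++ us

Rotation-refl : Rotation xs xs
Rotation-refl {xs = xs} = [] , xs , refl , sym (++-identityʳ xs)

Rotation-sym : Rotation xs ys → Rotation ys xs
Rotation-sym (us , vs , p , q) = vs , us , q , p

Rotation-trans : Rotation xs ys → Rotation ys zs → Rotation xs zs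
Rotation-trans (us , vs , refl , p) (us′ , vs′ , q , refl) with ++-≡-++⁻ vs {cs = us′} (trans (sym p) q)
... | inj₁ (es , refl , refl) = es , vs′ ++ vs , ++-assoc es vs′ vs , sym (++-assoc vs′ vs es)
... | inj₂ (es , refl , refl) = us ++ us′ , es , sym (++-assoc us us′ es) , ++-assoc es us us′

Rotation-≢[] : Rotation xs ys → xs ≢ [] → ys ≢ []
Rotation-≢[] (us , []     , refl , refl) us++[]≢[] = us++[]≢[] ∘ trans (++-identityʳ us)
Rotation-≢[] (us , v ∷ vs , refl , refl) _         = λ ()

Rotation⇒↭ : Rotation xs ys → xs ↭ ys
Rotation⇒↭ (us , vs , refl , refl) = ++-comm us vs

Rotation-⊆ : xs ⊆ ys → Rotation zs ys → ∃[ xs′ ] Rotation xs xs′ × xs′ ⊆ zs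
Rotation-⊆ xs⊆ys (us , vs , refl , refl) with ⊆-++⁻ vs xs⊆ys
... | xs₁ , xs₂ , refl , p₁ , p₂ = xs₂ ++ xs₁ , (xs₁ , xs₂ , refl , refl) , ++⁺ p₂ p₁

Rotation-∷-≡ : Unique (x ∷ xs) → Rotation (x ∷ xs) (x ∷ ys) → xs ≡ ys
Rotation-∷-≡ _ ([] , _ , refl , q) = sym (∷-injectiveʳ (trans q (++-identityʳ _)))
Rotation-∷-≡ _ (u ∷ us , [] , p , refl) = ∷-injectiveʳ (trans p (++-identityʳ _))
Rotation-∷-≡ (u∉ ∷ _) (u ∷ us , v ∷ vs , refl , refl) = contradiction refl (All.lookup u∉ (∈-insert us))

∈-subseqs⁻ : ∀ {s} τ → s ∈ subseqs τ → s ⊆ τ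
∈-subseqs⁻ []      (here refl) = []
∈-subseqs⁻ (x ∷ τ) s∈ with ∈-++⁻ (map (x ∷_) (subseqs τ)) s∈
... | inj₁ s∈₁ with ∈-map⁻ (x ∷_) s∈₁
...   | _ , s′∈ , refl = refl ∷ ∈-subseqs⁻ τ s′∈
∈-subseqs⁻ (x ∷ τ) s∈ | inj₂ s∈₂ = x ∷ʳ ∈-subseqs⁻ τ s∈₂

∈-subseqs⁺ : ∀ {s τ} → s ⊆ τ → s ∈ subseqs τ
∈-subseqs⁺ []                       = here refl
∈-subseqs⁺ (_∷ʳ_ {ys = τ} x p)      = ∈-++⁺ʳ (map (x ∷_) (subseqs τ)) (∈-subseqs⁺ p)
∈-subseqs⁺ (refl ∷ p)               = ∈-++⁺ˡ (∈-map⁺ _ (∈-subseqs⁺ p))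

contains⁻ : ∀ σ π → T (contains σ π) → ∃[ s ] s ⊆ σ × T (orderIso s π)
contains⁻ σ π c with any-∈⁻ _ (subseqs σ) c
... | s , s∈ , o = s , ∈-subseqs⁻ σ s∈ , o

contains⁺ : ∀ {s σ} π → s ⊆ σ → T (orderIso s π) → T (contains σ π)
contains⁺ π s⊆σ = any-∈⁺ (λ s → orderIso s π) (∈-subseqs⁺ s⊆σ)

∈-rotations⁻ : ∀ {σ τ} → τ ∈ rotations σ → Rotation σ τ
∈-rotations⁻ {σ} τ∈ with ∈-map⁻ (λ k → rotate k σ) τ∈
... | k , _ , refl = take k σ , drop k σ , sym (take++drop≡id k σ) , refl

rotation-∈-rotations : ∀ us v vs → (v ∷ vs) ++ us ∈ rotations (us ++ v ∷ vs)
rotation-∈-rotations us v vs =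
  subst (_∈ rotations (us ++ v ∷ vs)) (cong₂ _++_ (drop-length-++ us) (take-length-++ us))
        (∈-map⁺ (λ k → rotate k (us ++ v ∷ vs)) (∈-upTo⁺ us<))
  where
  us< : length us < length (us ++ v ∷ vs)
  us< = subst (length us <_) (sym (length-insert us)) (s≤s (length-++-≤ˡ us))

∈-rotations⁺ : ∀ {σ τ} → σ ≢ [] → Rotation σ τ → τ ∈ rotations σ
∈-rotations⁺ σ≢[] ([] , [] , refl , refl) = contradiction refl σ≢[]
∈-rotations⁺ _ (u ∷ us , [] , refl , refl) =
  subst (_∈ rotations (u ∷ us ++ [])) (trans (++-identityʳ _) (cong (u ∷_) (++-identityʳ us)))
        (rotation-∈-rotations [] u (us ++ []))
∈-rotations⁺ _ (us , v ∷ vs , refl , refl) = rotation-∈-rotations us v vs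

any-rotations⁻ : ∀ (p : List ℕ → Bool) σ → T (any p (rotations σ)) → ∃[ τ ] Rotation σ τ × T (p τ)
any-rotations⁻ p σ h with any-∈⁻ p (rotations σ) h
... | τ , τ∈ , pτ = τ , ∈-rotations⁻ τ∈ , pτ

any-rotations⁺ : ∀ (p : List ℕ → Bool) {σ τ} → σ ≢ [] → Rotation σ τ → T (p τ) → T (any p (rotations σ))
any-rotations⁺ p σ≢[] r = any-∈⁺ p (∈-rotations⁺ σ≢[] r)

cycContains-resp-Rotation : ∀ {σ τ} π → σ ≢ [] → Rotation σ τ → T (cycContains τ π) → T (cycContains σ π)
cycContains-resp-Rotation {τ = τ} π σ≢[] r c with any-rotations⁻ (λ ρ → contains ρ π) τ c
... | ρ , r′ , cρ = any-rotations⁺ (λ ρ → contains ρ π) σ≢[] (Rotation-trans r r′) cρ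

eqList⇒≡ : ∀ xs ys → T (eqList xs ys) → xs ≡ ys
eqList⇒≡ []       []       _ = refl
eqList⇒≡ (x ∷ xs) (y ∷ ys) h with T-∧⁻ (x ≡ᵇ y) h
... | x≡ᵇy , h′ = cong₂ _∷_ (≡ᵇ⇒≡ x y x≡ᵇy) (eqList⇒≡ xs ys h′)

eqList-refl : ∀ xs → T (eqList xs xs)
eqList-refl []       = _
eqList-refl (x ∷ xs) = T-∧⁺ (x ≡ᵇ x) (≡⇒≡ᵇ x x refl) (eqList-refl xs)

sameCyc⇒Rotation : ∀ {σ τ} → T (sameCyc σ τ) → Rotation σ τ
sameCyc⇒Rotation {σ} {τ} h with any-rotations⁻ (eqList τ) σ h
... | ρ , r , τ≡ρ rewrite eqList⇒≡ τ ρ τ≡ρ = r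

Rotation⇒sameCyc : ∀ {σ τ} → σ ≢ [] → Rotation σ τ → T (sameCyc σ τ)
Rotation⇒sameCyc {τ = τ} σ≢[] r = any-rotations⁺ (eqList τ) σ≢[] r (eqList-refl τ)

sameCyc-≢[] : ∀ {σ τ} → T (sameCyc σ τ) → σ ≢ []
sameCyc-≢[] {[]} ()
sameCyc-≢[] {_ ∷ _} _ ()

sameCyc-sym : ∀ σ τ → T (sameCyc σ τ) → T (sameCyc τ σ)
sameCyc-sym σ τ h = Rotation⇒sameCyc (Rotation-≢[] r (sameCyc-≢[] {σ} {τ} h)) (Rotation-sym r)
  where
  r : Rotation σ τ
  r = sameCyc⇒Rotation {σ} {τ} h

sameCyc-trans : ∀ σ τ ρ → T (sameCyc σ τ) → T (sameCyc τ ρ) → T (sameCyc σ ρ)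
sameCyc-trans σ τ ρ h h′ =
  Rotation⇒sameCyc (sameCyc-≢[] {σ} {τ} h)
                   (Rotation-trans (sameCyc⇒Rotation {σ} h) (sameCyc⇒Rotation {τ} {ρ} h′))

SameSide : ℕ → ℕ → ℕ → ℕ → Set
SameSide a b x y = (a < x ⇔ b < y) × (x < a ⇔ y < b)

sameSide-reflects : ∀ a b x y →
  Reflects (SameSide a b x y) (iffᵇ (a <ᵇ x) (b <ᵇ y) ∧ iffᵇ (x <ᵇ a) (y <ᵇ b))
sameSide-reflects a b x y =
  iffᵇ-reflects (<ᵇ-reflects-< a x) (<ᵇ-reflects-< b y) ×-reflects
  iffᵇ-reflects (<ᵇ-reflects-< x a) (<ᵇ-reflects-< y b)

sameSide-< : ∀ {a b x y} → a < x → b < y → SameSide a b x y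
sameSide-< a<x b<y = mk⇔ (λ _ → b<y) (λ _ → a<x) , mk⇔ (contradiction a<x ∘ <⇒≯) (contradiction b<y ∘ <⇒≯)

sameSide-> : ∀ {a b x y} → x < a → y < b → SameSide a b x y
sameSide-> x<a y<b = mk⇔ (contradiction x<a ∘ <⇒≯) (contradiction y<b ∘ <⇒≯) , mk⇔ (λ _ → y<b) (λ _ → x<a)

all-zip⁻ : ∀ {B : Set} {f : A × B → Bool} {R : A → B → Set} → (∀ {x y} → T (f (x , y)) → R x y) →
           ∀ xs ys → T (length xs ≡ᵇ length ys) → T (all f (zip xs ys)) → Pointwise R xs ys
all-zip⁻ _ []       []       _ _ = []
all-zip⁻ {f = f} fR (x ∷ xs) (y ∷ ys) l h with T-∧⁻ (f (x , y)) h
... | fxy , h′ = fR fxy ∷ all-zip⁻ fR xs ys l h′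

all-zip⁺ : ∀ {B : Set} {f : A × B → Bool} {R : A → B → Set} → (∀ {x y} → R x y → T (f (x , y))) →
           ∀ {xs ys} → Pointwise R xs ys → T (all f (zip xs ys))
all-zip⁺ _ []                     = _
all-zip⁺ {f = f} Rf (_∷_ {x} {y} r rs) = T-∧⁺ (f (x , y)) (Rf r) (all-zip⁺ Rf rs)

orderIso-∷⁻ : ∀ a s b p → T (orderIso (a ∷ s) (b ∷ p)) → Pointwise (SameSide a b) s p × T (orderIso s p)
orderIso-∷⁻ a s b p h with T-∧⁻ (length s ≡ᵇ length p) h
... | l , h′ with T-∧⁻ (all _ (zip s p)) h′
...   | w , o = all-zip⁻ (to (Reflects⇒T⇔ (sameSide-reflects a b _ _))) s p l w , o

orderIso-∷⁺ : ∀ {a s b p} → Pointwise (SameSide a b) s p → T (orderIso s p) → T (orderIso (a ∷ s) (b ∷ p))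
orderIso-∷⁺ {a} {s} {b} {p} rs o =
  T-∧⁺ (length s ≡ᵇ length p) (≡⇒≡ᵇ _ _ (Pointwise-length rs))
       (T-∧⁺ (all _ (zip s p)) (all-zip⁺ (from (Reflects⇒T⇔ (sameSide-reflects a b _ _))) rs) o)

p1324 p1423 : List ℕ
p1324 = 1 ∷ 3 ∷ 2 ∷ 4 ∷ []
p1423 = 1 ∷ 4 ∷ 2 ∷ 3 ∷ []

patterns : List (List ℕ)
patterns = p1324 ∷ p1423 ∷ []

MinBeforeValley : List ℕ → Set
MinBeforeValley s = ∃[ a ] ∃[ b ] ∃[ c ] ∃[ d ] s ≡ a ∷ b ∷ c ∷ d ∷ [] × a < c × c < b × c < d

orderIso-4⁻ : ∀ s p q r t → T (orderIso s (p ∷ q ∷ r ∷ t ∷ [])) →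
  ∃[ a ] ∃[ b ] ∃[ c ] ∃[ d ] s ≡ a ∷ b ∷ c ∷ d ∷ [] × SameSide a p c r × SameSide b q c r × SameSide c r d t
orderIso-4⁻ (a ∷ b ∷ c ∷ d ∷ []) p q r t h
  with orderIso-∷⁻ a (b ∷ c ∷ d ∷ []) p (q ∷ r ∷ t ∷ []) h
... | _ ∷ ac ∷ _ ∷ [] , h₁ with orderIso-∷⁻ b (c ∷ d ∷ []) q (r ∷ t ∷ []) h₁
...   | bc ∷ _ ∷ [] , h₂ with orderIso-∷⁻ c (d ∷ []) r (t ∷ []) h₂
...     | cd ∷ [] , _ = a , b , c , d , refl , ac , bc , cd
orderIso-4⁻ [] _ _ _ _ ()
orderIso-4⁻ (_ ∷ []) _ _ _ _ ()
orderIso-4⁻ (_ ∷ _ ∷ []) _ _ _ _ ()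
orderIso-4⁻ (_ ∷ _ ∷ _ ∷ []) _ _ _ _ ()
orderIso-4⁻ (_ ∷ _ ∷ _ ∷ _ ∷ _ ∷ _) _ _ _ _ ()

orderIso-1324⇒ : ∀ s → T (orderIso s p1324) → MinBeforeValley s
orderIso-1324⇒ s h with orderIso-4⁻ s 1 3 2 4 h
... | a , b , c , d , s≡ , ac , bc , cd =
  a , b , c , d , s≡ , from (proj₁ ac) (<ᵇ⇒< 1 2 _) , from (proj₂ bc) (<ᵇ⇒< 2 3 _) , from (proj₁ cd) (<ᵇ⇒< 2 4 _)

orderIso-1423⇒ : ∀ s → T (orderIso s p1423) → MinBeforeValley s
orderIso-1423⇒ s h with orderIso-4⁻ s 1 4 2 3 h
... | a , b , c , d , s≡ , ac , bc , cd =
  a , b , c , d , s≡ , from (proj₁ ac) (<ᵇ⇒< 1 2 _) , from (proj₂ bc) (<ᵇ⇒< 2 4 _) , from (proj₁ cd) (<ᵇ⇒< 2 3 _)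

orderIso-1324⇐ : ∀ {x y z} → 0 < y → y < x → x < z → T (orderIso (0 ∷ x ∷ y ∷ z ∷ []) p1324)
orderIso-1324⇐ {x} {y} {z} 0<y y<x x<z =
  orderIso-∷⁺ (sameSide-< 0<x (<ᵇ⇒< 1 3 _) ∷ sameSide-< 0<y (<ᵇ⇒< 1 2 _) ∷ sameSide-< 0<z (<ᵇ⇒< 1 4 _) ∷ [])
  (orderIso-∷⁺ (sameSide-> y<x (<ᵇ⇒< 2 3 _) ∷ sameSide-< x<z (<ᵇ⇒< 3 4 _) ∷ [])
  (orderIso-∷⁺ (sameSide-< (<-trans y<x x<z) (<ᵇ⇒< 2 4 _) ∷ [])
  _))
  where
  0<x : 0 < x
  0<x = <-trans 0<y y<x
  0<z : 0 < z
  0<z = <-trans 0<x x<z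

orderIso-1423⇐ : ∀ {x y z} → 0 < y → y < z → z < x → T (orderIso (0 ∷ x ∷ y ∷ z ∷ []) p1423)
orderIso-1423⇐ {x} {y} {z} 0<y y<z z<x =
  orderIso-∷⁺ (sameSide-< 0<x (<ᵇ⇒< 1 4 _) ∷ sameSide-< 0<y (<ᵇ⇒< 1 2 _) ∷ sameSide-< 0<z (<ᵇ⇒< 1 3 _) ∷ [])
  (orderIso-∷⁺ (sameSide-> (<-trans y<z z<x) (<ᵇ⇒< 2 4 _) ∷ sameSide-> z<x (<ᵇ⇒< 3 4 _) ∷ [])
  (orderIso-∷⁺ (sameSide-< y<z (<ᵇ⇒< 2 3 _) ∷ [])
  _))
  where
  0<z : 0 < z
  0<z = <-trans 0<y y<z
  0<x : 0 < x
  0<x = <-trans 0<z z<x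

Valley : List ℕ → Set
Valley α = ∃[ x ] ∃[ y ] ∃[ z ] x ∷ y ∷ z ∷ [] ⊆ α × y < x × y < z

Valley-resp-⊆ : ∀ {α β} → α ⊆ β → Valley α → Valley β
Valley-resp-⊆ α⊆β (x , y , z , v⊆α , y<x , y<z) = x , y , z , ⊆-trans v⊆α α⊆β , y<x , y<z

Valley-∷-min : ∀ {m α} → All (m ≤_) α → Valley (m ∷ α) → Valley α
Valley-∷-min _   (x , y , z , _ ∷ʳ v⊆ , y<x , y<z) = x , y , z , v⊆ , y<x , y<z
Valley-∷-min m≤α (x , y , z , refl ∷ v⊆ , y<x , y<z) =
  contradiction (All.lookup m≤α (Any-resp-⊆ v⊆ (here refl))) (<⇒≱ y<x)

Valley-∷ʳ-min : ∀ {m α} → All (m ≤_) α → Valley (α ++ [ m ]) → Valley α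
Valley-∷ʳ-min {m} {α} m≤α (x , y , z , v⊆ , y<x , y<z) with ⊆-++⁻ α v⊆
... | v₁ , [] , eq , v₁⊆ , _ = x , y , z , subst (_⊆ α) (trans (sym (++-identityʳ v₁)) (sym eq)) v₁⊆ , y<x , y<z
... | _ , _ ∷ [] , _ , _ , _ ∷ʳ ()
... | _ , _ ∷ _ ∷ _ , _ , _ , _ ∷ʳ ()
... | _ , _ ∷ _ ∷ _ , _ , _ , _ ∷ ()
... | v₁ , _ ∷ [] , eq , v₁⊆ , refl ∷ [] with ∷ʳ-injective (x ∷ y ∷ []) v₁ eq
...   | refl , refl = contradiction (All.lookup m≤α (Any-resp-⊆ v₁⊆ (there (here refl)))) (<⇒≱ y<z)

MinBeforeValley-Rotation : ∀ {s s′} → MinBeforeValley s → Rotation s s′ → Valley s′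
MinBeforeValley-Rotation (a , b , c , d , refl , a<c , c<b , c<d) (us , vs , eq , refl) = valley us vs eq
  where
  a<b : a < b
  a<b = <-trans a<c c<b
  a<d : a < d
  a<d = <-trans a<c c<d
  valley : ∀ us vs → a ∷ b ∷ c ∷ d ∷ [] ≡ us ++ vs → Valley (vs ++ us)
  valley []                     _       refl = b , c , d , a ∷ʳ ⊆-refl , c<b , c<d
  valley (_ ∷ [])               _       refl = b , c , d , refl ∷ refl ∷ refl ∷ a ∷ʳ [] , c<b , c<d
  valley (_ ∷ _ ∷ [])           _       refl = d , a , b , c ∷ʳ refl ∷ refl ∷ refl ∷ [] , a<d , a<b
  valley (_ ∷ _ ∷ _ ∷ [])       _       refl = d , a , b , refl ∷ refl ∷ refl ∷ c ∷ʳ [] , a<d , a<b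
  valley (_ ∷ _ ∷ _ ∷ _ ∷ [])   []      refl = b , c , d , a ∷ʳ ⊆-refl , c<b , c<d
  valley (_ ∷ _ ∷ _ ∷ _ ∷ [])   (_ ∷ _) ()
  valley (_ ∷ _ ∷ _ ∷ _ ∷ _ ∷ _) _       ()

occurrence⇒MinBeforeValley : ∀ {π} s → π ∈ patterns → T (orderIso s π) → MinBeforeValley s
occurrence⇒MinBeforeValley s (here refl)         = orderIso-1324⇒ s
occurrence⇒MinBeforeValley s (there (here refl)) = orderIso-1423⇒ s

cycContains⇒Valley : ∀ σ {π} → π ∈ patterns → T (cycContains σ π) → Valley σ
cycContains⇒Valley σ {π} π∈ c with any-rotations⁻ (λ τ → contains τ π) σ c
... | τ , r , cτ with contains⁻ τ π cτ
...   | s , s⊆τ , o with Rotation-⊆ s⊆τ r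
...     | s′ , rs , s′⊆σ =
  Valley-resp-⊆ s′⊆σ (MinBeforeValley-Rotation (occurrence⇒MinBeforeValley s π∈ o) rs)

Valley⇒cycContains : ∀ {α} → Unique (0 ∷ α) → Valley α → Any (λ π → T (cycContains (0 ∷ α) π)) patterns
Valley⇒cycContains {α} (0∉α ∷ uα) (x , y , z , v⊆α , y<x , y<z) = byComparison (<-cmp x z)
  where
  0<y : 0 < y
  0<y = n≢0⇒n>0 (All.lookup 0∉α (Any-resp-⊆ v⊆α (there (here refl))) ∘ sym)
  containedAt : ∀ π → T (orderIso (0 ∷ x ∷ y ∷ z ∷ []) π) → T (cycContains (0 ∷ α) π)
  containedAt π o =
    any-rotations⁺ (λ τ → contains τ π) {0 ∷ α} (λ ()) Rotation-refl (contains⁺ π (refl ∷ v⊆α) o)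
  byComparison : Tri (x < z) (x ≡ z) (z < x) → Any (λ π → T (cycContains (0 ∷ α) π)) patterns
  byComparison (tri< x<z _ _) = here (containedAt p1324 (orderIso-1324⇐ 0<y y<x x<z))
  byComparison (tri> _ _ z<x) = there (here (containedAt p1423 (orderIso-1423⇐ 0<y y<z z<x)))
  byComparison (tri≈ _ x≡z _) = contradiction x≡z (Unique-⊆-≢ (⊆-trans (refl ∷ y ∷ʳ refl ∷ []) v⊆α) uα)

cycAvoidsAll⇔ : ∀ Π σ → T (cycAvoidsAll Π σ) ⇔ All (λ π → ¬ T (cycContains σ π)) Π
cycAvoidsAll⇔ Π σ = mk⇔
  (λ a → All.map (to T-not⇔¬T) (all⁺ _ Π a))
  (λ a → all⁻ _ (All.map (from T-not⇔¬T) a))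

cycAvoidsAll-resp-Rotation : ∀ Π {σ τ} → σ ≢ [] → Rotation σ τ → T (cycAvoidsAll Π σ) → T (cycAvoidsAll Π τ)
cycAvoidsAll-resp-Rotation Π {σ} {τ} σ≢[] r a =
  from (cycAvoidsAll⇔ Π τ)
       (All.map (λ {π} ¬c c → ¬c (cycContains-resp-Rotation π σ≢[] r c)) (to (cycAvoidsAll⇔ Π σ) a))

avoids⇔¬Valley : ∀ {α} → Unique (0 ∷ α) → T (cycAvoidsAll patterns (0 ∷ α)) ⇔ (¬ Valley α)
avoids⇔¬Valley {α} u = mk⇔
  (λ a v → All¬⇒¬Any (to (cycAvoidsAll⇔ patterns (0 ∷ α)) a) (Valley⇒cycContains u v))
  (λ ¬v → from (cycAvoidsAll⇔ patterns (0 ∷ α))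
    (All.tabulate (λ π∈ c →
      ¬v (Valley-∷-min (All.universal (λ _ → z≤n) α) (cycContains⇒Valley (0 ∷ α) π∈ c)))))

record Arrangement (lo n : ℕ) (α : List ℕ) : Set where
  constructor arrangement
  field
    length≡ : length α ≡ n
    unique  : Unique α
    bounded : All (λ x → lo ≤ x × x < lo + n) α

Arrangement-resp-↭ : ∀ {lo n α β} → α ↭ β → Arrangement lo n α → Arrangement lo n β
Arrangement-resp-↭ α↭β (arrangement l u b) =
  arrangement (trans (sym (↭-length α↭β)) l) (Unique-resp-↭ α↭β u) (All-resp-↭ α↭β b)

Arrangement-∷⁻ : ∀ {lo n α} → Arrangement lo (suc n) (lo ∷ α) → Arrangement (suc lo) n α
Arrangement-∷⁻ {lo} {n} (arrangement l (lo∉α ∷ u) (_ ∷ b)) =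
  arrangement (suc-injective l) u (All.zipWith (λ (lo≢x , bx) → shift-bounds lo≢x bx) (lo∉α , b))
  where
  shift-bounds : ∀ {x} → lo ≢ x → lo ≤ x × x < lo + suc n → suc lo ≤ x × x < suc lo + n
  shift-bounds {x} lo≢x (lo≤x , x<) = ≤∧≢⇒< lo≤x lo≢x , subst (x <_) (+-suc lo n) x<

Arrangement-∷⁺ : ∀ {lo n α} → Arrangement (suc lo) n α → Arrangement lo (suc n) (lo ∷ α)
Arrangement-∷⁺ {lo} {n} (arrangement l u b) =
  arrangement (cong suc l) (All.map (λ (lo<x , _) → <⇒≢ lo<x) b ∷ u)
              ((≤-refl , m<m+n lo z<s) ∷ All.map widen-bounds b)
  where
  widen-bounds : ∀ {x} → suc lo ≤ x × x < suc lo + n → lo ≤ x × x < lo + suc n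
  widen-bounds {x} (lo<x , x<) = <⇒≤ lo<x , subst (x <_) (sym (+-suc lo n)) x<

Arrangement-∈ : ∀ {lo n α x} → Arrangement lo n α → lo ≤ x → x < lo + n → x ∈ α
Arrangement-∈ {lo} {n} (arrangement l u b) lo≤x x< =
  unique-length-≥⇒⊇ _≟_ u (λ z∈ → let (lo≤z , z<) = All.lookup b z∈ in ∈-interval lo≤z z<)
    (≤-reflexive (trans (length-applyUpTo (lo +_) n) (sym l))) (∈-interval lo≤x x<)
  where
  ∈-interval : ∀ {z} → lo ≤ z → z < lo + n → z ∈ applyUpTo (lo +_) n
  ∈-interval {z} lo≤z z< = subst (_∈ applyUpTo (lo +_) n) (m+[n∸m]≡n lo≤z)
    (∈-applyUpTo⁺ (lo +_) (+-cancelˡ-< lo _ _ (subst (_< lo + n) (sym (m+[n∸m]≡n lo≤z)) z<)))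

Arrangement-≢[] : ∀ {lo n α} → Arrangement lo (suc n) α → α ≢ []
Arrangement-≢[] (arrangement () _ _) refl

distinct⇒Unique : ∀ w → T (distinct w) → Unique w
distinct⇒Unique []      _ = []
distinct⇒Unique (x ∷ w) h with T-∧⁻ (not (any (x ≡ᵇ_) w)) h
... | x∉w , h′ = All.tabulate (λ y∈w x≡y → to T-not⇔¬T x∉w (any-∈⁺ (x ≡ᵇ_) y∈w (≡⇒≡ᵇ x _ x≡y)))
               ∷ distinct⇒Unique w h′

Unique⇒distinct : ∀ {w} → Unique w → T (distinct w)
Unique⇒distinct {[]}    []        = _
Unique⇒distinct {x ∷ w} (x∉w ∷ u) = T-∧⁺ (not (any (x ≡ᵇ_) w)) (from T-not⇔¬T x∉w′) (Unique⇒distinct u)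
  where
  x∉w′ : ¬ T (any (x ≡ᵇ_) w)
  x∉w′ a with any-∈⁻ (x ≡ᵇ_) w a
  ... | y , y∈w , x≡ᵇy = All.lookup x∉w y∈w (≡ᵇ⇒≡ x y x≡ᵇy)

∈-words⁻ : ∀ m k {w} → w ∈ words m k → length w ≡ k × All (_< m) w
∈-words⁻ m zero    (here refl) = refl , []
∈-words⁻ m (suc k) w∈ with ∈-concat⁻′ (map (λ x → map (x ∷_) (words m k)) (upTo m)) w∈
... | _ , w∈xs , xs∈ with ∈-map⁻ (λ x → map (x ∷_) (words m k)) xs∈
...   | x , x∈ , refl with ∈-map⁻ (x ∷_) w∈xs
...     | w′ , w′∈ , refl with ∈-words⁻ m k w′∈
...       | l , b = cong suc l , ∈-upTo⁻ x∈ ∷ b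

∈-words⁺ : ∀ m k {w} → length w ≡ k → All (_< m) w → w ∈ words m k
∈-words⁺ m zero    {[]}    _ _       = here refl
∈-words⁺ m (suc k) {x ∷ w} l (x<m ∷ b) =
  ∈-concat⁺′ (∈-map⁺ (x ∷_) (∈-words⁺ m k (suc-injective l) b))
             (∈-map⁺ (λ x → map (x ∷_) (words m k)) (∈-upTo⁺ x<m))

∈-perms⁻ : ∀ n {σ} → σ ∈ perms n → Arrangement 0 n σ
∈-perms⁻ n σ∈ with ∈-filter⁻ (λ w → distinct w ≟ᵇ true) σ∈
... | σ∈words , d with ∈-words⁻ n n σ∈words
...   | l , b = arrangement l (distinct⇒Unique _ (from T-≡ d)) (All.map (z≤n ,_) b)

∈-perms⁺ : ∀ n {σ} → Arrangement 0 n σ → σ ∈ perms n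
∈-perms⁺ n (arrangement l u b) =
  ∈-filter⁺ (λ w → distinct w ≟ᵇ true) (∈-words⁺ n n l (All.map proj₂ b)) (to T-≡ (Unique⇒distinct u))

-- The least entry of a valley-free arrangement of lo, …, lo + m sits at one of its ends.
unimodal : ℕ → ℕ → List (List ℕ)
unimodal lo zero    = [ [ lo ] ]
unimodal lo (suc m) = map (lo ∷_) (unimodal (suc lo) m) ++ map (_++ [ lo ]) (unimodal (suc lo) m)

Arrangement-lower-bound : ∀ {lo n α} → Arrangement (suc lo) n α → All (lo ≤_) α
Arrangement-lower-bound (arrangement _ _ b) = All.map (λ (lo<x , _) → <⇒≤ lo<x) b

unimodal-sound : ∀ lo m {α} → α ∈ unimodal lo m → Arrangement lo (suc m) α × ¬ Valley α
unimodal-sound lo zero (here refl) =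
  arrangement refl ([] ∷ []) ((≤-refl , m<m+n lo z<s) ∷ []) ,
  λ { (_ , _ , _ , _ ∷ʳ () , _) ; (_ , _ , _ , _ ∷ () , _) }
unimodal-sound lo (suc m) α∈ with ∈-++⁻ (map (lo ∷_) (unimodal (suc lo) m)) α∈
... | inj₁ α∈₁ with ∈-map⁻ (lo ∷_) α∈₁
...   | β , β∈ , refl with unimodal-sound (suc lo) m β∈
...     | arr , ¬v = Arrangement-∷⁺ arr , ¬v ∘ Valley-∷-min (Arrangement-lower-bound arr)
unimodal-sound lo (suc m) α∈ | inj₂ α∈₂ with ∈-map⁻ (_++ [ lo ]) α∈₂
...   | β , β∈ , refl with unimodal-sound (suc lo) m β∈
...     | arr , ¬v = Arrangement-resp-↭ (++-comm [ lo ] β) (Arrangement-∷⁺ arr) ,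
                     ¬v ∘ Valley-∷ʳ-min (Arrangement-lower-bound arr)

unimodal-complete : ∀ lo m {α} → Arrangement lo (suc m) α → ¬ Valley α → α ∈ unimodal lo m
unimodal-complete lo zero {a ∷ []} (arrangement _ _ ((lo≤a , a<) ∷ [])) _ =
  here (cong [_] (≤-antisym (m<1+n⇒m≤n (subst (a <_) (+-comm lo 1) a<)) lo≤a))
unimodal-complete lo (suc m) arr ¬v with ∈-∃++ (Arrangement-∈ arr ≤-refl (m<m+n lo z<s))
... | [] , vs , refl =
  ∈-++⁺ˡ (∈-map⁺ (lo ∷_) (unimodal-complete (suc lo) m (Arrangement-∷⁻ arr) (¬v ∘ Valley-resp-⊆ (lo ∷ʳ ⊆-refl))))
... | u ∷ us , [] , refl =
  ∈-++⁺ʳ (map (lo ∷_) (unimodal (suc lo) m)) (∈-map⁺ (_++ [ lo ])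
    (subst (_∈ unimodal (suc lo) m) (++-identityʳ (u ∷ us))
      (unimodal-complete (suc lo) m (Arrangement-∷⁻ (Arrangement-resp-↭ (shift lo (u ∷ us) []) arr))
                                    (¬v ∘ Valley-resp-⊆ (delete-⊆ (u ∷ us))))))
... | u ∷ us , v ∷ vs , refl = contradiction (u , lo , v , ulov⊆ , lo<u , lo<v) ¬v
  where
  open Arrangement arr
  ulov⊆ : u ∷ lo ∷ v ∷ [] ⊆ u ∷ us ++ lo ∷ v ∷ vs
  ulov⊆ = refl ∷ ++⁺ˡ us (refl ∷ refl ∷ []⊆-universal vs)
  lo<u : lo < u
  lo<u = ≤∧≢⇒< (proj₁ (All.lookup bounded (here refl)))
                (Unique-⊆-≢ (⊆-trans (refl ∷ refl ∷ v ∷ʳ []) ulov⊆) unique ∘ sym)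
  lo<v : lo < v
  lo<v = ≤∧≢⇒< (proj₁ (All.lookup bounded (Any-resp-⊆ ulov⊆ (there (there (here refl))))))
                (Unique-⊆-≢ (⊆-trans (u ∷ʳ ⊆-refl) ulov⊆) unique)

unimodal-unique : ∀ lo m → Unique (unimodal lo m)
unimodal-unique lo zero    = [] ∷ []
unimodal-unique lo (suc m) =
  Unique.++⁺ (Unique.map⁺ ∷-injectiveʳ (unimodal-unique (suc lo) m))
             (Unique.map⁺ (λ {β} {γ} → ∷ʳ-injectiveˡ β γ) (unimodal-unique (suc lo) m))
             disjoint
  where
  disjoint : ∀ {α} → α ∈ map (lo ∷_) (unimodal (suc lo) m) × α ∈ map (_++ [ lo ]) (unimodal (suc lo) m) → ⊥
  disjoint (α∈₁ , α∈₂) with ∈-map⁻ (lo ∷_) α∈₁ | ∈-map⁻ (_++ [ lo ]) α∈₂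
  ... | _ , _ , refl | _ , γ∈ , lo∷β≡γ++lo with unimodal-sound (suc lo) m γ∈
  ...   | arrangement _ _ ((lo<c , _) ∷ _) , _ = <⇒≢ lo<c (proj₁ (∷-injective lo∷β≡γ++lo))

length-unimodal : ∀ lo m → length (unimodal lo m) ≡ 2 ^ m
length-unimodal lo zero    = refl
length-unimodal lo (suc m) = begin
  length (map (lo ∷_) U ++ map (_++ [ lo ]) U)          ≡⟨ length-++ (map (lo ∷_) U) ⟩
  length (map (lo ∷_) U) + length (map (_++ [ lo ]) U)  ≡⟨ cong₂ _+_ (length-map (lo ∷_) U) (length-map (_++ [ lo ]) U) ⟩
  length U + length U                                    ≡⟨ cong (λ k → k + k) (length-unimodal (suc lo) m) ⟩
  2 ^ m + 2 ^ m                                          ≡⟨ cong (2 ^ m +_) (+-identityʳ (2 ^ m)) ⟨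
  2 ^ suc m                                              ∎
  where
  open ≡-Reasoning
  U : List (List ℕ)
  U = unimodal (suc lo) m

avoiders : ℕ → List (List ℕ)
avoiders n = filter (λ σ → cycAvoidsAll patterns σ ≟ᵇ true) (perms n)

∈-avoiders⁻ : ∀ n {σ} → σ ∈ avoiders n → Arrangement 0 n σ × T (cycAvoidsAll patterns σ)
∈-avoiders⁻ n σ∈ with ∈-filter⁻ (λ σ → cycAvoidsAll patterns σ ≟ᵇ true) σ∈
... | σ∈perms , a = ∈-perms⁻ n σ∈perms , from T-≡ a

∈-avoiders⁺ : ∀ n {σ} → Arrangement 0 n σ → T (cycAvoidsAll patterns σ) → σ ∈ avoiders n
∈-avoiders⁺ n arr a = ∈-filter⁺ (λ σ → cycAvoidsAll patterns σ ≟ᵇ true) (∈-perms⁺ n arr) (to T-≡ a)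

unimodal-transversal : ∀ m → Transversal sameCyc (avoiders (2 + m)) (map (0 ∷_) (unimodal 1 m))
unimodal-transversal m = record
  { unique    = Unique.map⁺ ∷-injectiveʳ (unimodal-unique 1 m)
  ; separated = separated
  ; covers    = covers
  ; hits      = hits
  }
  where
  rooted : ∀ {α} → α ∈ unimodal 1 m → Arrangement 0 (2 + m) (0 ∷ α) × ¬ Valley α
  rooted α∈ = let (arr , ¬v) = unimodal-sound 1 m α∈ in Arrangement-∷⁺ arr , ¬v

  separated : ∀ {r s} → r ∈ map (0 ∷_) (unimodal 1 m) → s ∈ map (0 ∷_) (unimodal 1 m) → T (sameCyc r s) → r ≡ s
  separated r∈ s∈ r∼s with ∈-map⁻ (0 ∷_) r∈ | ∈-map⁻ (0 ∷_) s∈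
  ... | α , α∈ , refl | β , _ , refl =
    cong (0 ∷_) (Rotation-∷-≡ (Arrangement.unique (proj₁ (rooted α∈))) (sameCyc⇒Rotation {0 ∷ α} r∼s))

  covers : ∀ {σ} → σ ∈ avoiders (2 + m) → ∃[ r ] r ∈ map (0 ∷_) (unimodal 1 m) × T (sameCyc σ r)
  covers σ∈ with ∈-avoiders⁻ (2 + m) σ∈
  ... | arr , av with ∈-∃++ (Arrangement-∈ arr z≤n z<s)
  ...   | us , vs , refl =
    0 ∷ vs ++ us , ∈-map⁺ (0 ∷_) (unimodal-complete 1 m arr′ ¬v) , Rotation⇒sameCyc σ≢[] r
    where
    r : Rotation (us ++ 0 ∷ vs) (0 ∷ vs ++ us)
    r = us , 0 ∷ vs , refl , refl
    σ≢[] : us ++ 0 ∷ vs ≢ []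
    σ≢[] = Arrangement-≢[] arr
    arrτ : Arrangement 0 (2 + m) (0 ∷ vs ++ us)
    arrτ = Arrangement-resp-↭ (Rotation⇒↭ r) arr
    arr′ : Arrangement 1 (suc m) (vs ++ us)
    arr′ = Arrangement-∷⁻ arrτ
    ¬v : ¬ Valley (vs ++ us)
    ¬v = to (avoids⇔¬Valley (Arrangement.unique arrτ)) (cycAvoidsAll-resp-Rotation patterns σ≢[] r av)

  hits : ∀ {r} → r ∈ map (0 ∷_) (unimodal 1 m) → ∃[ σ ] σ ∈ avoiders (2 + m) × T (sameCyc r σ)
  hits r∈ with ∈-map⁻ (0 ∷_) r∈
  ... | α , α∈ , refl with rooted α∈
  ...   | arr , ¬v = 0 ∷ α , ∈-avoiders⁺ (2 + m) arr (from (avoids⇔¬Valley (Arrangement.unique arr)) ¬v) ,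
                     Rotation⇒sameCyc {0 ∷ α} (λ ()) Rotation-refl

mainTheorem8 : (n : ℕ) → 3 ≤ n →
    numAv n ((1 ∷ 3 ∷ 2 ∷ 4 ∷ []) ∷ (1 ∷ 4 ∷ 2 ∷ 3 ∷ []) ∷ []) ≡ 2 ^ (n ∸ 2)
mainTheorem8 0             ()
mainTheorem8 1             (s≤s ())
mainTheorem8 (suc (suc m)) _ = begin
  countClasses (avoiders (2 + m))       ≡⟨ countClasses≡classCount (avoiders (2 + m)) ⟩
  classCount sameCyc (avoiders (2 + m)) ≡⟨ classCount-transversal sameCyc sameCyc-sym sameCyc-trans
                                             (avoiders (2 + m)) (unimodal-transversal m) ⟩
  length (map (0 ∷_) (unimodal 1 m))    ≡⟨ length-map (0 ∷_) (unimodal 1 m) ⟩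
  length (unimodal 1 m)                 ≡⟨ length-unimodal 1 m ⟩
  2 ^ m                                 ∎
  where open ≡-Reasoning
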